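{- Let $q$ be a prime power, $d\ge 2$, $z\in\mathbb{F}_q\setminus\{0\}$, $E\subseteq\mathbb{F}_q^d$, and let $\Theta\subseteq\mathbb{F}_q^{d-1}$ be nonempty. Then there exists $\theta\in\Theta$ such that \[ |E\cdot(\theta,z)|\ge q\,\frac{|E||\Theta|}{q^d+|E||\Theta|}. \] In particular, if $|E||\Theta|>q^d$, then there exists $\theta\in\Theta$ such that $|E\cdot(\theta,z)|>q/2$.
   Context: For $\theta=(\theta_1,\dots,\theta_{d-1})\in\mathbb{F}_q^{d-1}$ and $z\in\mathbb{F}_q$, $(\theta,z)$ denotes the vector $(\theta_1,\dots,\theta_{d-1},z)\in\mathbb{F}_q^d$. For $E\subseteq\mathbb{F}_q^d$ and $v\in\mathbb{F}_q^d$, $E\cdot v=\{u\cdot v: u\in E\}$, with $u\cdot v=\sum_j u_jv_j$. -}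

module Defs where

open import Level using (0ℓ)
open import Data.Nat as ℕ using (ℕ; suc)
open import Data.Fin as Fin using (Fin)
open import Data.Fin.Properties as FinP using ()
open import Data.Product using (∃; _,_)
open import Data.List as List using (List; length; filter; map; allFin)
open import Data.List.Relation.Unary.Any using (Any; any?)
open import Data.Vec as Vec using (Vec; foldr′; zipWith)
open import Function.Bundles using (_↔_; Inverse)
open import Relation.Nullary using (¬_; Dec; yes; no)
open import Relation.Binary.PropositionalEquality using (_≡_; refl; cong; sym; trans)
open import Algebra.Structures using (IsCommutativeRing)

-- Its order q = size is automatically a prime
-- power, and every prime power arises this way, so quantifying over all
-- finite fields is the same as quantifying over all F_q, q a prime power.
record FiniteField : Set₁ where
  infixl 6 _+_
  infixl 7 _*_
  field
    Carrier : Set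
    _+_ _*_ : Carrier → Carrier → Carrier
    -_      : Carrier → Carrier
    0# 1#   : Carrier
    isCommutativeRing : IsCommutativeRing _≡_ _+_ _*_ -_ 0# 1#
    0≢1     : ¬ (0# ≡ 1#)
    inverse : ∀ x → ¬ (x ≡ 0#) → ∃ λ y → x * y ≡ 1#
    size    : ℕ
    enum    : Carrier ↔ Fin size

  _≟_ : (x y : Carrier) → Dec (x ≡ y)
  x ≟ y with Inverse.to enum x FinP.≟ Inverse.to enum y
  ... | yes p = yes (trans (sym (Inverse.strictlyInverseʳ enum x))
                     (trans (cong (Inverse.from enum) p) (Inverse.strictlyInverseʳ enum y)))
  ... | no ¬p = no (λ e → ¬p (cong (Inverse.to enum) e))

  elements : List Carrier
  elements = map (Inverse.from enum) (allFin size)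

  _·_ : ∀ {m} → Vec Carrier m → Vec Carrier m → Carrier
  u · v = foldr′ _+_ 0# (zipWith _*_ u v)

  -- |E · v| : number of field elements c with c = u · v for some u ∈ E
  -- (E is a finite subset of F^m given as a duplicate-free list)
  dotSetSize : ∀ {m} → List (Vec Carrier m) → Vec Carrier m → ℕ
  dotSetSize E v = length (filter (λ c → any? (λ u → (u · v) ≟ c) E) elements)

-- For θ ∈ F^(d-1) let ν_θ(c) = #{u ∈ E : u·(θ,z) = c}; its energy Σ_c ν_θ(c)² counts the
-- pairs (u,u′) ∈ E² with u·(θ,z) = u′·(θ,z). By Cauchy–Schwarz |E|² ≤ |E·(θ,z)|·energy and
-- |E|² ≤ q·energy. For u ≠ u′ the condition (u − u′)·(θ,z) = 0 is a non-trivial affine equation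
-- in θ (inconsistent if u, u′ differ only in the last coordinate, as z ≠ 0), so it has at most
-- q^(d-2) solutions. Summing over θ ∈ F^(d-1), the excesses q·energy − |E|² add up to at most
-- |E|q^d, so some θ ∈ Θ has excess at most |E|q^d/|Θ|; the first Cauchy–Schwarz bound then gives
-- q|E||Θ| ≤ |E·(θ,z)|(q^d + |E||Θ|).

module Submission where

open import Defs
open import Level using (0ℓ)
open import Algebra.Bundles using (CommutativeRing)
open import Data.Nat using (ℕ; zero; suc; _*_; _+_; _∸_; _^_; _≤_; _<_; z≤n; s≤s; >-nonZero⁻¹)
open import Data.Nat.Properties hiding (_≟_)
open import Data.Nat.Tactic.RingSolver using (solve-∀)
open import Data.Product using (∃; _×_; _,_; proj₁; proj₂)
open import Data.Sum using (inj₁; inj₂; [_,_]′)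
open import Data.Empty using (⊥-elim)
open import Data.Fin.Properties using (nonZeroIndex)
open import Data.List using (List; []; _∷_; [_]; length; map; filter; concatMap; _++_; allFin)
open import Data.List.Properties using (length-map; length-tabulate)
open import Data.List.Relation.Unary.Unique.Propositional using (Unique)
open import Data.List.Relation.Unary.Unique.Propositional.Properties using (map⁺; allFin⁺)
open import Data.List.Relation.Unary.AllPairs using ([]; _∷_)
import Data.List.Relation.Unary.All as All
open import Data.List.Relation.Unary.All.Properties using (All¬⇒¬Any)
open import Data.List.Relation.Unary.Any using (Any; any?; here; there; satisfied)
open import Data.List.Membership.Propositional using (_∈_)
open import Data.List.Membership.Propositional.Properties using (∈-map⁺; ∈-allFin)
open import Data.Vec using (Vec; []; _∷_; _∷ʳ_; initLast)
open import Data.Vec.Properties using (≡-dec; ∷-injective)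
open import Function using (_∘_)
open import Function.Bundles using (Inverse)
open import Relation.Nullary using (¬_; Dec; yes; no; contradiction)
open import Relation.Unary using (Decidable)
open import Relation.Binary.Definitions using (DecidableEquality)
open import Relation.Binary.PropositionalEquality hiding ([_])

𝟙 : {P : Set} → Dec P → ℕ
𝟙 (yes _) = 1
𝟙 (no _)  = 0

module _ {P : Set} where

  𝟙≤1 : (p : Dec P) → 𝟙 p ≤ 1
  𝟙≤1 (yes _) = s≤s z≤n
  𝟙≤1 (no _)  = z≤n

  𝟙-yes : P → (p : Dec P) → 𝟙 p ≡ 1
  𝟙-yes _  (yes _) = refl
  𝟙-yes x  (no ¬x) = ⊥-elim (¬x x)

  𝟙-no : ¬ P → (p : Dec P) → 𝟙 p ≡ 0
  𝟙-no ¬x (yes x) = ⊥-elim (¬x x)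
  𝟙-no _  (no _)  = refl

module _ {P Q : Set} where

  𝟙-cong : (P → Q) → (Q → P) → (p : Dec P) (q : Dec Q) → 𝟙 p ≡ 𝟙 q
  𝟙-cong f g (yes p) (yes q) = refl
  𝟙-cong f g (yes p) (no ¬q) = ⊥-elim (¬q (f p))
  𝟙-cong f g (no ¬p) (yes q) = ⊥-elim (¬p (g q))
  𝟙-cong f g (no ¬p) (no ¬q) = refl

  𝟙-× : ∀ {R : Set} → (R → P × Q) → (P × Q → R) →
        (r : Dec R) (p : Dec P) (q : Dec Q) → 𝟙 r ≡ 𝟙 p * 𝟙 q
  𝟙-× f g r (yes p) (yes q) = 𝟙-yes (g (p , q)) r
  𝟙-× f g r (yes p) (no ¬q) = 𝟙-no (¬q ∘ proj₂ ∘ f) r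
  𝟙-× f g r (no ¬p) _       = 𝟙-no (¬p ∘ proj₁ ∘ f) r

∑ : {A : Set} → List A → (A → ℕ) → ℕ
∑ []       f = 0
∑ (x ∷ xs) f = f x + ∑ xs f

infixr 8 ∑
syntax ∑ L (λ x → e) = ∑[ x ∈ L ] e

module _ {A : Set} where

  ∑-cong : ∀ L {f g : A → ℕ} → (∀ x → f x ≡ g x) → ∑ L f ≡ ∑ L g
  ∑-cong []      f≡g = refl
  ∑-cong (x ∷ L) f≡g = cong₂ _+_ (f≡g x) (∑-cong L f≡g)

  ∑-mono-≤ : ∀ L {f g : A → ℕ} → (∀ x → f x ≤ g x) → ∑ L f ≤ ∑ L g
  ∑-mono-≤ []      f≤g = z≤n
  ∑-mono-≤ (x ∷ L) f≤g = +-mono-≤ (f≤g x) (∑-mono-≤ L f≤g)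

  ∑-distrib-+ : ∀ L (f g : A → ℕ) → ∑[ x ∈ L ] (f x + g x) ≡ ∑ L f + ∑ L g
  ∑-distrib-+ []      f g = refl
  ∑-distrib-+ (x ∷ L) f g = begin
    (f x + g x) + ∑[ y ∈ L ] (f y + g y) ≡⟨ cong (f x + g x +_) (∑-distrib-+ L f g) ⟩
    (f x + g x) + (∑ L f + ∑ L g)        ≡⟨ +-comm-middle (f x) (g x) (∑ L f) (∑ L g) ⟩
    (f x + ∑ L f) + (g x + ∑ L g)        ∎
    where
    open ≡-Reasoning
    +-comm-middle : ∀ a b c d → (a + b) + (c + d) ≡ (a + c) + (b + d)
    +-comm-middle = solve-∀

  ∑-*ˡ : ∀ L k (f : A → ℕ) → ∑[ x ∈ L ] (k * f x) ≡ k * ∑ L f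
  ∑-*ˡ []      k f = sym (*-zeroʳ k)
  ∑-*ˡ (x ∷ L) k f = trans (cong (k * f x +_) (∑-*ˡ L k f)) (sym (*-distribˡ-+ k (f x) (∑ L f)))

  ∑-*ʳ : ∀ L k (f : A → ℕ) → ∑[ x ∈ L ] (f x * k) ≡ ∑ L f * k
  ∑-*ʳ L k f = begin
    ∑[ x ∈ L ] (f x * k) ≡⟨ ∑-cong L (λ x → *-comm (f x) k) ⟩
    ∑[ x ∈ L ] (k * f x) ≡⟨ ∑-*ˡ L k f ⟩
    k * ∑ L f            ≡⟨ *-comm k (∑ L f) ⟩
    ∑ L f * k            ∎
    where open ≡-Reasoning

  ∑-const : ∀ (L : List A) k → ∑[ _ ∈ L ] k ≡ length L * k
  ∑-const []      k = refl
  ∑-const (x ∷ L) k = cong (k +_) (∑-const L k)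

  length≡∑1 : ∀ (L : List A) → length L ≡ ∑[ _ ∈ L ] 1
  length≡∑1 L = sym (trans (∑-const L 1) (*-identityʳ (length L)))

  ∑𝟙≤length : ∀ L {P : A → Set} (P? : Decidable P) → ∑[ x ∈ L ] 𝟙 (P? x) ≤ length L
  ∑𝟙≤length L P? = ≤-trans (∑-mono-≤ L (λ x → 𝟙≤1 (P? x))) (≤-reflexive (sym (length≡∑1 L)))

  ∑-∸ : ∀ L (f : A → ℕ) k → (∀ x → k ≤ f x) → ∑[ x ∈ L ] (f x ∸ k) + length L * k ≡ ∑ L f
  ∑-∸ L f k k≤f = begin
    ∑ L f∸k + length L * k     ≡⟨ cong (∑ L f∸k +_) (sym (∑-const L k)) ⟩
    ∑ L f∸k + ∑[ _ ∈ L ] k     ≡⟨ sym (∑-distrib-+ L _ _) ⟩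
    ∑[ x ∈ L ] (f x ∸ k + k)   ≡⟨ ∑-cong L (λ x → m∸n+n≡m (k≤f x)) ⟩
    ∑ L f                      ∎
    where
    open ≡-Reasoning
    f∸k : A → ℕ
    f∸k x = f x ∸ k

  ∑-filter-≤ : ∀ {P : A → Set} (P? : Decidable P) L (f : A → ℕ) → ∑ (filter P? L) f ≤ ∑ L f
  ∑-filter-≤ P? []      f = z≤n
  ∑-filter-≤ P? (x ∷ L) f with P? x
  ... | yes _ = +-monoʳ-≤ (f x) (∑-filter-≤ P? L f)
  ... | no _  = m≤n⇒m≤o+n (f x) (∑-filter-≤ P? L f)

  ∑-filter-≡ : ∀ {P : A → Set} (P? : Decidable P) L (f : A → ℕ) →
               (∀ x → ¬ P x → f x ≡ 0) → ∑ (filter P? L) f ≡ ∑ L f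
  ∑-filter-≡ P? []      f f≡0 = refl
  ∑-filter-≡ P? (x ∷ L) f f≡0 with P? x
  ... | yes _ = cong (f x +_) (∑-filter-≡ P? L f f≡0)
  ... | no ¬p = trans (∑-filter-≡ P? L f f≡0) (cong (_+ ∑ L f) (sym (f≡0 x ¬p)))

module _ {A B : Set} where

  ∑-map : ∀ (h : A → B) L (f : B → ℕ) → ∑ (map h L) f ≡ ∑[ x ∈ L ] f (h x)
  ∑-map h []      f = refl
  ∑-map h (x ∷ L) f = cong (f (h x) +_) (∑-map h L f)

  ∑-++ : ∀ (L M : List B) (f : B → ℕ) → ∑ (L ++ M) f ≡ ∑ L f + ∑ M f
  ∑-++ []      M f = refl
  ∑-++ (x ∷ L) M f = trans (cong (f x +_) (∑-++ L M f)) (sym (+-assoc (f x) _ _))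

  ∑-concatMap : ∀ (h : A → List B) L (f : B → ℕ) → ∑ (concatMap h L) f ≡ ∑[ x ∈ L ] ∑ (h x) f
  ∑-concatMap h []      f = refl
  ∑-concatMap h (x ∷ L) f = trans (∑-++ (h x) (concatMap h L) f) (cong (∑ (h x) f +_) (∑-concatMap h L f))

  ∑-comm : ∀ (L : List A) (M : List B) (f : A → B → ℕ) →
           ∑[ x ∈ L ] ∑ M (f x) ≡ ∑[ y ∈ M ] ∑[ x ∈ L ] f x y
  ∑-comm []      M f = sym (trans (∑-const M 0) (*-zeroʳ (length M)))
  ∑-comm (x ∷ L) M f = trans (cong (∑ M (f x) +_) (∑-comm L M f))
                             (sym (∑-distrib-+ M (f x) (λ y → ∑[ x′ ∈ L ] f x′ y)))

  ∑-*-∑ : ∀ (L : List A) (M : List B) f g → ∑ L f * ∑ M g ≡ ∑[ x ∈ L ] ∑[ y ∈ M ] (f x * g y)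
  ∑-*-∑ L M f g = trans (sym (∑-*ʳ L (∑ M g) f)) (∑-cong L (λ x → sym (∑-*ˡ M (f x) g)))

2*m*n≤m*m+n*n : ∀ m n → 2 * (m * n) ≤ m * m + n * n
2*m*n≤m*m+n*n m n = [ ordered , flipped ]′ (≤-total m n)
  where
  ordered : ∀ {m n} → m ≤ n → 2 * (m * n) ≤ m * m + n * n
  ordered {m} m≤n with m≤n⇒∃[o]m+o≡n m≤n
  ... | k , refl = subst (2 * (m * (m + k)) ≤_) (expand m k) (m≤m+n _ (k * k))
    where
    expand : ∀ m k → 2 * (m * (m + k)) + k * k ≡ m * m + (m + k) * (m + k)
    expand = solve-∀
  flipped : n ≤ m → 2 * (m * n) ≤ m * m + n * n
  flipped n≤m = subst₂ _≤_ (cong (2 *_) (*-comm n m)) (+-comm (n * n) (m * m)) (ordered n≤m)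

module _ {A : Set} where

  cauchy-schwarz : ∀ (L : List A) f → ∑ L f * ∑ L f ≤ length L * ∑[ x ∈ L ] (f x * f x)
  cauchy-schwarz L f = *-cancelˡ-≤ 2 (begin
    2 * (∑ L f * ∑ L f)                           ≡⟨ cong (2 *_) (∑-*-∑ L L f f) ⟩
    2 * ∑[ x ∈ L ] ∑[ y ∈ L ] (f x * f y)
      ≡⟨ sym (trans (∑-cong L (λ x → ∑-*ˡ L 2 _)) (∑-*ˡ L 2 _)) ⟩
    ∑[ x ∈ L ] ∑[ y ∈ L ] (2 * (f x * f y))
      ≤⟨ ∑-mono-≤ L (λ x → ∑-mono-≤ L (λ y → 2*m*n≤m*m+n*n (f x) (f y))) ⟩
    ∑[ x ∈ L ] ∑[ y ∈ L ] (f x * f x + f y * f y)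
      ≡⟨ ∑-cong L (λ x → trans (∑-distrib-+ L _ _) (cong (_+ Q) (∑-const L _))) ⟩
    ∑[ x ∈ L ] (length L * (f x * f x) + Q)
      ≡⟨ trans (∑-distrib-+ L _ _) (cong₂ _+_ (∑-*ˡ L (length L) square) (∑-const L Q)) ⟩
    length L * Q + length L * Q
      ≡⟨ cong (length L * Q +_) (sym (+-identityʳ _)) ⟩
    2 * (length L * Q)                            ∎)
    where
    open ≤-Reasoning
    square : A → ℕ
    square x = f x * f x
    Q = ∑ L square

  ∃-below-average : ∀ (L : List A) → ¬ L ≡ [] → (f : A → ℕ) →
                    ∃ λ x → x ∈ L × length L * f x ≤ ∑ L f
  ∃-below-average []           L≢[] f = ⊥-elim (L≢[] refl)
  ∃-below-average (x ∷ [])     _    f = x , here refl , ≤-refl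
  ∃-below-average (x ∷ y ∷ ys) _    f with ∃-below-average (y ∷ ys) (λ ()) f
  ... | x′ , x′∈ , avg with ≤-total (f x) (f x′)
  ... | inj₁ fx≤fx′ =
    x , here refl , +-monoʳ-≤ (f x) (≤-trans (*-monoʳ-≤ (length (y ∷ ys)) fx≤fx′) avg)
  ... | inj₂ fx′≤fx = x′ , there x′∈ , +-mono-≤ fx′≤fx avg

  ∑𝟙-none : ∀ {P : A → Set} (P? : Decidable P) L → ¬ Any P L → ∑[ x ∈ L ] 𝟙 (P? x) ≡ 0
  ∑𝟙-none P? []      _    = refl
  ∑𝟙-none P? (x ∷ L) ¬any = cong₂ _+_ (𝟙-no (¬any ∘ here) (P? x)) (∑𝟙-none P? L (¬any ∘ there))

module _ {A : Set} (_≟_ : DecidableEquality A) where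

  multiplicity : List A → A → ℕ
  multiplicity L y = ∑[ x ∈ L ] 𝟙 (x ≟ y)

  Enumerates : List A → Set
  Enumerates L = ∀ y → multiplicity L y ≡ 1

  𝟙-≟-sym : ∀ x y → 𝟙 (x ≟ y) ≡ 𝟙 (y ≟ x)
  𝟙-≟-sym x y = 𝟙-cong sym sym (x ≟ y) (y ≟ x)

  multiplicity-unique : ∀ {L} → Unique L → ∀ y → multiplicity L y ≤ 1
  multiplicity-unique {[]}    []              y = z≤n
  multiplicity-unique {x ∷ L} (x∉L ∷ unique) y with x ≟ y
  ... | yes refl = ≤-reflexive (cong suc (∑𝟙-none (_≟ y) L (All¬⇒¬Any (All.map (_∘ sym) x∉L))))
  ... | no _     = multiplicity-unique unique y

  multiplicity-∈ : ∀ {L y} → y ∈ L → 1 ≤ multiplicity L y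
  multiplicity-∈ {x ∷ L} {y} (here refl) = ≤-trans (≤-reflexive (sym (𝟙-yes refl (y ≟ y)))) (m≤m+n _ _)
  multiplicity-∈ {x ∷ L}     (there y∈L) = ≤-trans (multiplicity-∈ y∈L) (m≤n+m _ _)

  unique⇒enumerates : ∀ {L} → Unique L → (∀ y → y ∈ L) → Enumerates L
  unique⇒enumerates unique complete y = ≤-antisym (multiplicity-unique unique y) (multiplicity-∈ (complete y))

  ∑-sift : ∀ L y (f : A → ℕ) → ∑[ x ∈ L ] (𝟙 (x ≟ y) * f x) ≡ multiplicity L y * f y
  ∑-sift L y f = trans (∑-cong L at-y) (∑-*ʳ L (f y) (λ x → 𝟙 (x ≟ y)))
    where
    at-y : ∀ x → 𝟙 (x ≟ y) * f x ≡ 𝟙 (x ≟ y) * f y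
    at-y x with x ≟ y
    ... | yes refl = refl
    ... | no _     = refl

  ∑-⊆-enumeration : ∀ Univ → Enumerates Univ → ∀ {Θ} → Unique Θ →
                    (f : A → ℕ) → ∑ Θ f ≤ ∑ Univ f
  ∑-⊆-enumeration Univ enum {Θ} unique f = begin
    ∑ Θ f
      ≡⟨ ∑-cong Θ sifted ⟩
    ∑[ θ ∈ Θ ] ∑[ x ∈ Univ ] (𝟙 (x ≟ θ) * f x)
      ≡⟨ ∑-comm Θ Univ _ ⟩
    ∑[ x ∈ Univ ] ∑[ θ ∈ Θ ] (𝟙 (x ≟ θ) * f x)
      ≡⟨ ∑-cong Univ (λ x → ∑-*ʳ Θ (f x) _) ⟩
    ∑[ x ∈ Univ ] (∑[ θ ∈ Θ ] 𝟙 (x ≟ θ) * f x)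
      ≤⟨ ∑-mono-≤ Univ (λ x → *-monoˡ-≤ (f x) (at-most-once x)) ⟩
    ∑[ x ∈ Univ ] (1 * f x)
      ≡⟨ ∑-cong Univ (λ x → *-identityˡ (f x)) ⟩
    ∑ Univ f ∎
    where
    open ≤-Reasoning
    sifted : ∀ θ → f θ ≡ ∑[ x ∈ Univ ] (𝟙 (x ≟ θ) * f x)
    sifted θ = sym (trans (∑-sift Univ θ f) (trans (cong (_* f θ) (enum θ)) (*-identityˡ (f θ))))
    at-most-once : ∀ x → ∑[ θ ∈ Θ ] 𝟙 (x ≟ θ) ≤ 1
    at-most-once x = ≤-trans (≤-reflexive (∑-cong Θ (𝟙-≟-sym x))) (multiplicity-unique unique x)

  ∑∑-≤-diagonal : ∀ {E} → Unique E → ∀ (h : A → A → ℕ) α β →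
                  (∀ u u′ → h u u′ ≤ α + β * 𝟙 (u ≟ u′)) →
                  ∑[ u ∈ E ] ∑[ u′ ∈ E ] h u u′ ≤ length E * (length E * α + β)
  ∑∑-≤-diagonal {E} unique h α β h≤ = begin
    ∑[ u ∈ E ] ∑[ u′ ∈ E ] h u u′
      ≤⟨ ∑-mono-≤ E (λ u → ∑-mono-≤ E (h≤ u)) ⟩
    ∑[ u ∈ E ] ∑[ u′ ∈ E ] (α + β * 𝟙 (u ≟ u′))
      ≡⟨ ∑-cong E (λ u → ∑-distrib-+ E _ _) ⟩
    ∑[ u ∈ E ] (∑[ _ ∈ E ] α + ∑[ u′ ∈ E ] (β * 𝟙 (u ≟ u′)))
      ≡⟨ ∑-cong E (λ u → cong₂ _+_ (∑-const E α) (∑-*ˡ E β _)) ⟩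
    ∑[ u ∈ E ] (length E * α + β * ∑[ u′ ∈ E ] 𝟙 (u ≟ u′))
      ≤⟨ ∑-mono-≤ E (λ u → +-monoʳ-≤ (length E * α) (*-monoʳ-≤ β (once u))) ⟩
    ∑[ _ ∈ E ] (length E * α + β * 1)
      ≡⟨ trans (∑-const E _) (cong (λ b → length E * (length E * α + b)) (*-identityʳ β)) ⟩
    length E * (length E * α + β) ∎
    where
    open ≤-Reasoning
    once : ∀ u → ∑[ u′ ∈ E ] 𝟙 (u ≟ u′) ≤ 1
    once u = ≤-trans (≤-reflexive (∑-cong E (𝟙-≟-sym u))) (multiplicity-unique unique u)

  ∑𝟙-unique-solution : ∀ L → (∀ y → multiplicity L y ≤ 1) →
                       ∀ {Q : A → Set} (Q? : Decidable Q) → (∀ {x y} → Q x → Q y → x ≡ y) →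
                       ∑[ x ∈ L ] 𝟙 (Q? x) ≤ 1
  ∑𝟙-unique-solution L mult≤1 Q? unique with any? Q? L
  ... | no ¬any = ≤-trans (≤-reflexive (∑𝟙-none Q? L ¬any)) z≤n
  ... | yes any with satisfied any
  ...   | x₀ , Qx₀ = ≤-trans (∑-mono-≤ L below) (mult≤1 x₀)
    where
    below : ∀ x → 𝟙 (Q? x) ≤ 𝟙 (x ≟ x₀)
    below x with Q? x
    ... | yes Qx = ≤-reflexive (sym (𝟙-yes (unique Qx Qx₀) (x ≟ x₀)))
    ... | no _   = z≤n

module Fibres {A B : Set} (_≟_ : DecidableEquality B) (Bs : List B) (Bs-enum : Enumerates _≟_ Bs)
              (g : A → B) (E : List A) where

  fibre : B → ℕ
  fibre c = ∑[ u ∈ E ] 𝟙 (g u ≟ c)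

  image : List B
  image = filter (λ c → any? (λ u → g u ≟ c) E) Bs

  energy : ℕ
  energy = ∑[ c ∈ Bs ] (fibre c * fibre c)

  ∑-fibre : ∑ Bs fibre ≡ length E
  ∑-fibre = begin
    ∑[ c ∈ Bs ] ∑[ u ∈ E ] 𝟙 (g u ≟ c)
      ≡⟨ ∑-comm Bs E _ ⟩
    ∑[ u ∈ E ] ∑[ c ∈ Bs ] 𝟙 (g u ≟ c)
      ≡⟨ ∑-cong E (λ u → trans (∑-cong Bs (𝟙-≟-sym _≟_ (g u))) (Bs-enum (g u))) ⟩
    ∑[ u ∈ E ] 1
      ≡⟨ sym (length≡∑1 E) ⟩
    length E ∎
    where open ≡-Reasoning

  energy≡collisions : energy ≡ ∑[ u ∈ E ] ∑[ u′ ∈ E ] 𝟙 (g u ≟ g u′)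
  energy≡collisions = begin
    ∑[ c ∈ Bs ] (fibre c * fibre c)
      ≡⟨ ∑-cong Bs (λ c → ∑-*-∑ E E _ _) ⟩
    ∑[ c ∈ Bs ] ∑[ u ∈ E ] ∑[ u′ ∈ E ] (𝟙 (g u ≟ c) * 𝟙 (g u′ ≟ c))
      ≡⟨ ∑-comm Bs E _ ⟩
    ∑[ u ∈ E ] ∑[ c ∈ Bs ] ∑[ u′ ∈ E ] (𝟙 (g u ≟ c) * 𝟙 (g u′ ≟ c))
      ≡⟨ ∑-cong E (λ u → ∑-comm Bs E _) ⟩
    ∑[ u ∈ E ] ∑[ u′ ∈ E ] ∑[ c ∈ Bs ] (𝟙 (g u ≟ c) * 𝟙 (g u′ ≟ c))
      ≡⟨ ∑-cong E (λ u → ∑-cong E (λ u′ → coincidence (g u) (g u′))) ⟩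
    ∑[ u ∈ E ] ∑[ u′ ∈ E ] 𝟙 (g u ≟ g u′) ∎
    where
    open ≡-Reasoning
    coincidence : ∀ b b′ → ∑[ c ∈ Bs ] (𝟙 (b ≟ c) * 𝟙 (b′ ≟ c)) ≡ 𝟙 (b ≟ b′)
    coincidence b b′ = begin
      ∑[ c ∈ Bs ] (𝟙 (b ≟ c) * 𝟙 (b′ ≟ c))
        ≡⟨ ∑-cong Bs (λ c → cong (_* 𝟙 (b′ ≟ c)) (𝟙-≟-sym _≟_ b c)) ⟩
      ∑[ c ∈ Bs ] (𝟙 (c ≟ b) * 𝟙 (b′ ≟ c))
        ≡⟨ ∑-sift _≟_ Bs b _ ⟩
      multiplicity _≟_ Bs b * 𝟙 (b′ ≟ b)
        ≡⟨ trans (cong (_* 𝟙 (b′ ≟ b)) (Bs-enum b)) (+-identityʳ _) ⟩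
      𝟙 (b′ ≟ b)
        ≡⟨ 𝟙-≟-sym _≟_ b′ b ⟩
      𝟙 (b ≟ b′) ∎

  length²≤|image|*energy : length E * length E ≤ length image * energy
  length²≤|image|*energy = begin
    length E * length E                                ≡⟨ cong (λ s → s * s) (sym ∑-fibre-image) ⟩
    ∑ image fibre * ∑ image fibre                      ≤⟨ cauchy-schwarz image fibre ⟩
    length image * ∑[ c ∈ image ] (fibre c * fibre c)  ≤⟨ *-monoʳ-≤ (length image) (∑-filter-≤ _ Bs _) ⟩
    length image * energy                              ∎
    where
    open ≤-Reasoning
    ∑-fibre-image : ∑ image fibre ≡ length E
    ∑-fibre-image = trans (∑-filter-≡ _ Bs fibre (λ c → ∑𝟙-none (λ u → g u ≟ c) E)) ∑-fibre

  length²≤|B|*energy : length E * length E ≤ length Bs * energy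
  length²≤|B|*energy = subst (λ s → s * s ≤ length Bs * energy) ∑-fibre (cauchy-schwarz Bs fibre)

-- Read e = |E|, t = |Θ|, k = |E·(θ,z)|, s = energy along θ and Q = q^d.
q*[e*t]≤k*[Q+e*t] : ∀ q e t k s Q → e * e ≤ k * s → e * e ≤ q * s → t * (q * s ∸ e * e) ≤ e * Q →
                    q * (e * t) ≤ k * (Q + e * t)
q*[e*t]≤k*[Q+e*t] q zero      t k s Q _  _  _  = ≤-trans (≤-reflexive (*-zeroʳ q)) z≤n
q*[e*t]≤k*[Q+e*t] q e@(suc _) t k s Q h₁ h₂ h₃ = *-cancelˡ-≤ e (begin
  e * (q * (e * t))           ≡⟨ regroup₁ e q t ⟩
  q * t * (e * e)             ≤⟨ *-monoʳ-≤ (q * t) h₁ ⟩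
  q * t * (k * s)             ≡⟨ regroup₂ q t k s ⟩
  k * (t * (q * s))           ≤⟨ *-monoʳ-≤ k t*q*s≤ ⟩
  k * (e * Q + t * (e * e))   ≡⟨ regroup₃ k e Q t ⟩
  e * (k * (Q + e * t))       ∎)
  where
  open ≤-Reasoning
  t*q*s≤ : t * (q * s) ≤ e * Q + t * (e * e)
  t*q*s≤ = begin
    t * (q * s)                        ≡⟨ cong (t *_) (sym (m∸n+n≡m h₂)) ⟩
    t * (q * s ∸ e * e + e * e)        ≡⟨ *-distribˡ-+ t _ _ ⟩
    t * (q * s ∸ e * e) + t * (e * e)  ≤⟨ +-monoˡ-≤ _ h₃ ⟩
    e * Q + t * (e * e)                ∎
  regroup₁ : ∀ e q t → e * (q * (e * t)) ≡ q * t * (e * e)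
  regroup₁ = solve-∀
  regroup₂ : ∀ q t k s → q * t * (k * s) ≡ k * (t * (q * s))
  regroup₂ = solve-∀
  regroup₃ : ∀ k e Q t → k * (e * Q + t * (e * e)) ≡ e * (k * (Q + e * t))
  regroup₃ = solve-∀

q*m≤k*[Q+m]⇒q<2*k : ∀ {q Q m k} → 0 < q → Q < m → q * m ≤ k * (Q + m) → q < 2 * k
q*m≤k*[Q+m]⇒q<2*k {k = zero} 0<q Q<m h =
  contradiction h (<⇒≱ (*-mono-< 0<q (m<n⇒0<n Q<m)))
q*m≤k*[Q+m]⇒q<2*k {q} {Q} {m} {k@(suc _)} _ Q<m h = *-cancelʳ-< m q (2 * k) (begin-strict
  q * m          ≤⟨ h ⟩
  k * (Q + m)    <⟨ *-monoʳ-< k (+-monoˡ-< m Q<m) ⟩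
  k * (m + m)    ≡⟨ double k m ⟩
  2 * k * m      ∎)
  where
  open ≤-Reasoning
  double : ∀ k m → k * (m + m) ≡ 2 * k * m
  double = solve-∀

module _ (F : FiniteField) where

  open FiniteField F renaming (Carrier to 𝔽; _+_ to _⊕_; _*_ to _⊗_; -_ to ⊖_; size to q)
  open Inverse enum using (to; from; strictlyInverseˡ; strictlyInverseʳ)

  private
    ring : CommutativeRing 0ℓ 0ℓ
    ring = record { isCommutativeRing = isCommutativeRing }
    module R = CommutativeRing ring

  open import Algebra.Properties.Group (CommutativeRing.+-group ring)
    using (//-rightDividesˡ; x∙y⁻¹≈ε⇒x≈y) renaming (∙-cancelˡ to +-cancelˡ; ∙-cancelʳ to +-cancelʳ)

  _≟ᵛ_ : ∀ {m} → (u v : Vec 𝔽 m) → Dec (u ≡ v)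
  _≟ᵛ_ = ≡-dec _≟_

  0<q : 0 < q
  0<q = >-nonZero⁻¹ q {{nonZeroIndex (to 0#)}}

  *-cancelʳ-≢0 : ∀ {z} → ¬ z ≡ 0# → ∀ x y → x ⊗ z ≡ y ⊗ z → x ≡ y
  *-cancelʳ-≢0 {z} z≢0 x y xz≡yz with inverse z z≢0
  ... | z⁻¹ , zz⁻¹≡1 = begin
    x                ≡⟨ sym (R.*-identityʳ x) ⟩
    x ⊗ 1#           ≡⟨ cong (x ⊗_) (sym zz⁻¹≡1) ⟩
    x ⊗ (z ⊗ z⁻¹)    ≡⟨ sym (R.*-assoc x z z⁻¹) ⟩
    (x ⊗ z) ⊗ z⁻¹    ≡⟨ cong (_⊗ z⁻¹) xz≡yz ⟩
    (y ⊗ z) ⊗ z⁻¹    ≡⟨ R.*-assoc y z z⁻¹ ⟩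
    y ⊗ (z ⊗ z⁻¹)    ≡⟨ cong (y ⊗_) zz⁻¹≡1 ⟩
    y ⊗ 1#           ≡⟨ R.*-identityʳ y ⟩
    y                ∎
    where open ≡-Reasoning

  affine-unique : ∀ {a b c c′} → ¬ a ≡ b → ∀ {x y} →
                  a ⊗ x ⊕ c ≡ b ⊗ x ⊕ c′ → a ⊗ y ⊕ c ≡ b ⊗ y ⊕ c′ → x ≡ y
  affine-unique {a} {b} {c} {c′} a≢b {x} {y} eqx eqy =
    *-cancelʳ-≢0 d≢0 x y (trans (R.*-comm x d) (trans dx≡dy (R.*-comm d y)))
    where
    open ≡-Reasoning
    d = a ⊕ ⊖ b
    d≢0 : ¬ d ≡ 0#
    d≢0 = a≢b ∘ x∙y⁻¹≈ε⇒x≈y a b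
    solved : ∀ {t} → a ⊗ t ⊕ c ≡ b ⊗ t ⊕ c′ → d ⊗ t ⊕ c ≡ c′
    solved {t} eq = +-cancelˡ (b ⊗ t) _ _ (begin
      b ⊗ t ⊕ (d ⊗ t ⊕ c)   ≡⟨ sym (R.+-assoc _ _ _) ⟩
      (b ⊗ t ⊕ d ⊗ t) ⊕ c   ≡⟨ cong (_⊕ c) (R.+-comm _ _) ⟩
      (d ⊗ t ⊕ b ⊗ t) ⊕ c   ≡⟨ cong (_⊕ c) (sym (R.distribʳ t d b)) ⟩
      (d ⊕ b) ⊗ t ⊕ c       ≡⟨ cong (λ s → s ⊗ t ⊕ c) (//-rightDividesˡ b a) ⟩
      a ⊗ t ⊕ c             ≡⟨ eq ⟩
      b ⊗ t ⊕ c′            ∎)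
    dx≡dy : d ⊗ x ≡ d ⊗ y
    dx≡dy = +-cancelʳ c _ _ (trans (solved eqx) (sym (solved eqy)))

  dot-∷ʳ : ∀ {m} (a θ : Vec 𝔽 m) l z → (a ∷ʳ l) · (θ ∷ʳ z) ≡ a · θ ⊕ l ⊗ z
  dot-∷ʳ []       []      l z = trans (R.+-identityʳ _) (sym (R.+-identityˡ _))
  dot-∷ʳ (a₀ ∷ a) (x ∷ θ) l z = trans (cong (a₀ ⊗ x ⊕_) (dot-∷ʳ a θ l z)) (sym (R.+-assoc _ _ _))

  elements-enumerates : Enumerates _≟_ elements
  elements-enumerates = unique⇒enumerates _≟_
    (map⁺ from-injective (allFin⁺ q))
    (λ x → subst (_∈ elements) (strictlyInverseʳ x) (∈-map⁺ from (∈-allFin (to x))))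
    where
    from-injective : ∀ {i j} → from i ≡ from j → i ≡ j
    from-injective {i} {j} eq = trans (sym (strictlyInverseˡ i)) (trans (cong to eq) (strictlyInverseˡ j))

  length-elements : length elements ≡ q
  length-elements = trans (length-map from (allFin q)) (length-tabulate _)

  vectors : ∀ m → List (Vec 𝔽 m)
  vectors zero    = [ [] ]
  vectors (suc m) = concatMap (λ x → map (x ∷_) (vectors m)) elements

  ∑-vectors-suc : ∀ m (f : Vec 𝔽 (suc m) → ℕ) →
                  ∑ (vectors (suc m)) f ≡ ∑[ x ∈ elements ] ∑[ θ ∈ vectors m ] f (x ∷ θ)
  ∑-vectors-suc m f = trans (∑-concatMap _ elements f) (∑-cong elements (λ x → ∑-map (x ∷_) (vectors m) f))

  length-vectors : ∀ m → length (vectors m) ≡ q ^ m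
  length-vectors zero    = refl
  length-vectors (suc m) = begin
    length (vectors (suc m))
      ≡⟨ length≡∑1 (vectors (suc m)) ⟩
    ∑[ _ ∈ vectors (suc m) ] 1
      ≡⟨ ∑-vectors-suc m _ ⟩
    ∑[ _ ∈ elements ] ∑[ _ ∈ vectors m ] 1
      ≡⟨ ∑-cong elements (λ _ → sym (length≡∑1 (vectors m))) ⟩
    ∑[ _ ∈ elements ] length (vectors m)
      ≡⟨ ∑-const elements _ ⟩
    length elements * length (vectors m)
      ≡⟨ cong₂ _*_ length-elements (length-vectors m) ⟩
    q * q ^ m ∎
    where open ≡-Reasoning

  vectors-enumerates : ∀ m → Enumerates _≟ᵛ_ (vectors m)
  vectors-enumerates zero    []      = refl
  vectors-enumerates (suc m) (y ∷ v) = begin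
    ∑[ u ∈ vectors (suc m) ] 𝟙 (u ≟ᵛ (y ∷ v))
      ≡⟨ ∑-vectors-suc m _ ⟩
    ∑[ x ∈ elements ] ∑[ θ ∈ vectors m ] 𝟙 ((x ∷ θ) ≟ᵛ (y ∷ v))
      ≡⟨ ∑-cong elements (λ x → ∑-cong (vectors m) (λ θ →
           𝟙-× ∷-injective (λ (p , r) → cong₂ _∷_ p r) _ (x ≟ y) (θ ≟ᵛ v))) ⟩
    ∑[ x ∈ elements ] ∑[ θ ∈ vectors m ] (𝟙 (x ≟ y) * 𝟙 (θ ≟ᵛ v))
      ≡⟨ ∑-cong elements (λ x → ∑-*ˡ (vectors m) (𝟙 (x ≟ y)) (λ θ → 𝟙 (θ ≟ᵛ v))) ⟩
    ∑[ x ∈ elements ] (𝟙 (x ≟ y) * multiplicity _≟ᵛ_ (vectors m) v)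
      ≡⟨ ∑-cong elements (λ x → cong (𝟙 (x ≟ y) *_) (vectors-enumerates m v)) ⟩
    ∑[ x ∈ elements ] (𝟙 (x ≟ y) * 1)
      ≡⟨ ∑-cong elements (λ x → *-identityʳ (𝟙 (x ≟ y))) ⟩
    multiplicity _≟_ elements y
      ≡⟨ elements-enumerates y ⟩
    1 ∎
    where open ≡-Reasoning

  affineSolutions : ∀ {m} (a b : Vec 𝔽 m) (c c′ : 𝔽) → ℕ
  affineSolutions {m} a b c c′ = ∑[ θ ∈ vectors m ] 𝟙 ((a · θ ⊕ c) ≟ (b · θ ⊕ c′))

  affineSolutions-∷ : ∀ {m} a₀ b₀ (a b : Vec 𝔽 m) c c′ →
                      affineSolutions (a₀ ∷ a) (b₀ ∷ b) c c′
                        ≡ ∑[ x ∈ elements ] affineSolutions a b (a₀ ⊗ x ⊕ c) (b₀ ⊗ x ⊕ c′)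
  affineSolutions-∷ {m} a₀ b₀ a b c c′ =
    trans (∑-vectors-suc m _) (∑-cong elements (λ x → ∑-cong (vectors m) (λ θ →
      𝟙-cong (λ eq → trans (sym (regroup _ _ c)) (trans eq (regroup _ _ c′)))
             (λ eq → trans (regroup _ _ c) (trans eq (sym (regroup _ _ c′)))) _ _)))
    where
    regroup : ∀ p s c → (p ⊕ s) ⊕ c ≡ s ⊕ (p ⊕ c)
    regroup p s c = trans (cong (_⊕ c) (R.+-comm p s)) (R.+-assoc s p c)

  affineSolutions-diagonal : ∀ {m} (a : Vec 𝔽 m) c c′ →
                             affineSolutions a a c c′ ≡ q ^ m * 𝟙 (c ≟ c′)
  affineSolutions-diagonal {m} a c c′ = begin
    ∑[ θ ∈ vectors m ] 𝟙 ((a · θ ⊕ c) ≟ (a · θ ⊕ c′))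
      ≡⟨ ∑-cong (vectors m) (λ θ → 𝟙-cong (+-cancelˡ _ _ _) (cong (a · θ ⊕_)) _ (c ≟ c′)) ⟩
    ∑[ θ ∈ vectors m ] 𝟙 (c ≟ c′)
      ≡⟨ ∑-const (vectors m) _ ⟩
    length (vectors m) * 𝟙 (c ≟ c′)
      ≡⟨ cong (_* 𝟙 (c ≟ c′)) (length-vectors m) ⟩
    q ^ m * 𝟙 (c ≟ c′) ∎
    where open ≡-Reasoning

  q*affineSolutions≤q^m : ∀ {m} {a b : Vec 𝔽 m} → ¬ a ≡ b → ∀ c c′ →
                          q * affineSolutions a b c c′ ≤ q ^ m
  q*affineSolutions≤q^m {zero}  {[]}     {[]}     a≢b = ⊥-elim (a≢b refl)
  q*affineSolutions≤q^m {suc m} {a₀ ∷ a} {b₀ ∷ b} a≢b c c′ with a ≟ᵛ b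
  ... | no a≢b′ = begin
    q * affineSolutions (a₀ ∷ a) (b₀ ∷ b) c c′
      ≡⟨ cong (q *_) (affineSolutions-∷ a₀ b₀ a b c c′) ⟩
    q * ∑[ x ∈ elements ] affineSolutions a b (a₀ ⊗ x ⊕ c) (b₀ ⊗ x ⊕ c′)
      ≡⟨ sym (∑-*ˡ elements q _) ⟩
    ∑[ x ∈ elements ] (q * affineSolutions a b (a₀ ⊗ x ⊕ c) (b₀ ⊗ x ⊕ c′))
      ≤⟨ ∑-mono-≤ elements (λ x → q*affineSolutions≤q^m a≢b′ _ _) ⟩
    ∑[ x ∈ elements ] q ^ m
      ≡⟨ trans (∑-const elements _) (cong (_* q ^ m) length-elements) ⟩
    q * q ^ m ∎
    where open ≤-Reasoning
  ... | yes refl = *-monoʳ-≤ q (begin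
    affineSolutions (a₀ ∷ a) (b₀ ∷ a) c c′
      ≡⟨ affineSolutions-∷ a₀ b₀ a a c c′ ⟩
    ∑[ x ∈ elements ] affineSolutions a a (a₀ ⊗ x ⊕ c) (b₀ ⊗ x ⊕ c′)
      ≡⟨ ∑-cong elements (λ x → affineSolutions-diagonal a _ _) ⟩
    ∑[ x ∈ elements ] (q ^ m * 𝟙 ((a₀ ⊗ x ⊕ c) ≟ (b₀ ⊗ x ⊕ c′)))
      ≡⟨ ∑-*ˡ elements (q ^ m) _ ⟩
    q ^ m * ∑[ x ∈ elements ] 𝟙 ((a₀ ⊗ x ⊕ c) ≟ (b₀ ⊗ x ⊕ c′))
      ≤⟨ *-monoʳ-≤ (q ^ m) (∑𝟙-unique-solution _≟_ elements (≤-reflexive ∘ elements-enumerates) _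
                                                (affine-unique a₀≢b₀)) ⟩
    q ^ m * 1
      ≡⟨ *-identityʳ (q ^ m) ⟩
    q ^ m ∎)
    where
    open ≤-Reasoning
    a₀≢b₀ : ¬ a₀ ≡ b₀
    a₀≢b₀ a₀≡b₀ = a≢b (cong (_∷ a) a₀≡b₀)

  module _ {z : 𝔽} (z≢0 : ¬ z ≡ 0#) {n : ℕ} where

    collisions : (u u′ : Vec 𝔽 (suc n)) → ℕ
    collisions u u′ = ∑[ θ ∈ vectors n ] 𝟙 ((u · (θ ∷ʳ z)) ≟ (u′ · (θ ∷ʳ z)))

    collisions-∷ʳ : ∀ a b l l′ →
                    collisions (a ∷ʳ l) (b ∷ʳ l′) ≡ affineSolutions a b (l ⊗ z) (l′ ⊗ z)
    collisions-∷ʳ a b l l′ = ∑-cong (vectors n) (λ θ → 𝟙-cong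
      (λ eq → trans (sym (dot-∷ʳ a θ l z)) (trans eq (dot-∷ʳ b θ l′ z)))
      (λ eq → trans (dot-∷ʳ a θ l z) (trans eq (sym (dot-∷ʳ b θ l′ z)))) _ _)

    q*collisions≤ : ∀ u u′ → q * collisions u u′ ≤ q ^ n + q ^ suc n * 𝟙 (u ≟ᵛ u′)
    q*collisions≤ u u′ with u ≟ᵛ u′
    ... | yes _ = begin
      q * collisions u u′       ≤⟨ *-monoʳ-≤ q (∑𝟙≤length (vectors n) _) ⟩
      q * length (vectors n)    ≡⟨ cong (q *_) (length-vectors n) ⟩
      q ^ suc n                 ≤⟨ m≤n+m _ (q ^ n) ⟩
      q ^ n + q ^ suc n         ≡⟨ cong (q ^ n +_) (sym (*-identityʳ _)) ⟩
      q ^ n + q ^ suc n * 1     ∎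
      where open ≤-Reasoning
    ... | no u≢u′ with initLast u | initLast u′
    ...   | a , l , refl | b , l′ , refl = ≤-trans (distinct (a ≟ᵛ b)) (m≤m+n _ _)
      where
      distinct : Dec (a ≡ b) → q * collisions (a ∷ʳ l) (b ∷ʳ l′) ≤ q ^ n
      distinct (no a≢b) =
        subst (λ s → q * s ≤ q ^ n) (sym (collisions-∷ʳ a b l l′)) (q*affineSolutions≤q^m a≢b _ _)
      distinct (yes refl) = ≤-trans (≤-reflexive no-collisions) z≤n
        where
        lz≢l′z : ¬ l ⊗ z ≡ l′ ⊗ z
        lz≢l′z eq = u≢u′ (cong (a ∷ʳ_) (*-cancelʳ-≢0 z≢0 l l′ eq))
        no-collisions : q * collisions (a ∷ʳ l) (a ∷ʳ l′) ≡ 0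
        no-collisions = begin
          q * collisions (a ∷ʳ l) (a ∷ʳ l′)
            ≡⟨ cong (q *_) (trans (collisions-∷ʳ a a l l′) (affineSolutions-diagonal a _ _)) ⟩
          q * (q ^ n * 𝟙 ((l ⊗ z) ≟ (l′ ⊗ z)))
            ≡⟨ cong (λ s → q * (q ^ n * s)) (𝟙-no lz≢l′z _) ⟩
          q * (q ^ n * 0)
            ≡⟨ trans (cong (q *_) (*-zeroʳ (q ^ n))) (*-zeroʳ q) ⟩
          0 ∎
          where open ≡-Reasoning

    module _ (E : List (Vec 𝔽 (suc n))) where

      -- length (Along.image θ) is, by definition, dotSetSize E (θ ∷ʳ z).
      module Along (θ : Vec 𝔽 n) = Fibres _≟_ elements elements-enumerates (_· (θ ∷ʳ z)) E
      open Along using (energy)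

      ∑-q*energy≤ : Unique E →
                    ∑[ θ ∈ vectors n ] (q * energy θ) ≤ length E * (length E * q ^ n + q ^ suc n)
      ∑-q*energy≤ unique = begin
        ∑[ θ ∈ vectors n ] (q * energy θ)
          ≡⟨ ∑-*ˡ (vectors n) q energy ⟩
        q * ∑[ θ ∈ vectors n ] energy θ
          ≡⟨ cong (q *_) (∑-cong (vectors n) Along.energy≡collisions) ⟩
        q * ∑[ θ ∈ vectors n ] ∑[ u ∈ E ] ∑[ u′ ∈ E ] 𝟙 (g θ u ≟ g θ u′)
          ≡⟨ cong (q *_) (∑-comm (vectors n) E _) ⟩
        q * ∑[ u ∈ E ] ∑[ θ ∈ vectors n ] ∑[ u′ ∈ E ] 𝟙 (g θ u ≟ g θ u′)
          ≡⟨ cong (q *_) (∑-cong E (λ u → ∑-comm (vectors n) E _)) ⟩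
        q * ∑[ u ∈ E ] ∑[ u′ ∈ E ] collisions u u′
          ≡⟨ sym (trans (∑-cong E (λ u → ∑-*ˡ E q _)) (∑-*ˡ E q _)) ⟩
        ∑[ u ∈ E ] ∑[ u′ ∈ E ] (q * collisions u u′)
          ≤⟨ ∑∑-≤-diagonal _≟ᵛ_ unique _ _ _ q*collisions≤ ⟩
        length E * (length E * q ^ n + q ^ suc n) ∎
        where
        open ≤-Reasoning
        g : Vec 𝔽 n → Vec 𝔽 (suc n) → 𝔽
        g θ u = u · (θ ∷ʳ z)

      excess : Vec 𝔽 n → ℕ
      excess θ = q * energy θ ∸ length E * length E

      length²≤q*energy : ∀ θ → length E * length E ≤ q * energy θ
      length²≤q*energy θ =
        subst (λ s → length E * length E ≤ s * energy θ) length-elements (Along.length²≤|B|*energy θ)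

      ∑-excess≤ : Unique E → ∑[ θ ∈ vectors n ] excess θ ≤ length E * q ^ suc n
      ∑-excess≤ unique = +-cancelʳ-≤ (q ^ n * (length E * length E)) _ _ (begin
        ∑[ θ ∈ vectors n ] excess θ + q ^ n * (length E * length E)
          ≡⟨ cong (λ s → ∑ (vectors n) excess + s * (length E * length E)) (sym (length-vectors n)) ⟩
        ∑[ θ ∈ vectors n ] excess θ + length (vectors n) * (length E * length E)
          ≡⟨ ∑-∸ (vectors n) _ _ length²≤q*energy ⟩
        ∑[ θ ∈ vectors n ] (q * energy θ)
          ≤⟨ ∑-q*energy≤ unique ⟩
        length E * (length E * q ^ n + q ^ suc n)
          ≡⟨ expand (length E) (q ^ n) (q ^ suc n) ⟩
        length E * q ^ suc n + q ^ n * (length E * length E) ∎)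
        where
        open ≤-Reasoning
        expand : ∀ e Q Q′ → e * (e * Q + Q′) ≡ e * Q′ + Q * (e * e)
        expand = solve-∀

      ∃-small-excess : Unique E → (Θ : List (Vec 𝔽 n)) → Unique Θ → ¬ Θ ≡ [] →
                       ∃ λ θ → θ ∈ Θ × length Θ * excess θ ≤ length E * q ^ suc n
      ∃-small-excess uniqueE Θ uniqueΘ Θ≢[] with ∃-below-average Θ Θ≢[] excess
      ... | θ , θ∈Θ , below = θ , θ∈Θ , (begin
        length Θ * excess θ
          ≤⟨ below ⟩
        ∑ Θ excess
          ≤⟨ ∑-⊆-enumeration _≟ᵛ_ (vectors n) (vectors-enumerates n) uniqueΘ excess ⟩
        ∑[ θ ∈ vectors n ] excess θ
          ≤⟨ ∑-excess≤ uniqueE ⟩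
        length E * q ^ suc n ∎)
        where open ≤-Reasoning

corollary2 : (F : FiniteField) →
  (n : ℕ) → 1 ≤ n →
  (z : FiniteField.Carrier F) → ¬ (z ≡ FiniteField.0# F) →
  (E : List (Vec (FiniteField.Carrier F) (suc n))) → Unique E →
  (Θ : List (Vec (FiniteField.Carrier F) n)) → Unique Θ → ¬ (Θ ≡ []) →
  (∃ λ θ → θ ∈ Θ ×
      FiniteField.size F * (length E * length Θ)
        ≤ FiniteField.dotSetSize F E (θ ∷ʳ z) * (FiniteField.size F ^ suc n + length E * length Θ))
  × (FiniteField.size F ^ suc n < length E * length Θ →
      ∃ λ θ → θ ∈ Θ × FiniteField.size F < 2 * FiniteField.dotSetSize F E (θ ∷ʳ z))
corollary2 F n _ z z≢0 E uniqueE Θ uniqueΘ Θ≢[] with ∃-small-excess F z≢0 E uniqueE Θ uniqueΘ Θ≢[]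
... | θ , θ∈Θ , small = (θ , θ∈Θ , bound) , λ q^d<|E||Θ| → θ , θ∈Θ , more-than-half q^d<|E||Θ|
  where
  open FiniteField F using (size; dotSetSize)
  open Along F z≢0 E θ using (energy; length²≤|image|*energy)
  k : ℕ
  k = dotSetSize E (θ ∷ʳ z)
  bound : size * (length E * length Θ) ≤ k * (size ^ suc n + length E * length Θ)
  bound = q*[e*t]≤k*[Q+e*t] size (length E) (length Θ) k energy (size ^ suc n)
            length²≤|image|*energy (length²≤q*energy F z≢0 E θ) small
  more-than-half : size ^ suc n < length E * length Θ → size < 2 * k
  more-than-half q^d<|E||Θ| = q*m≤k*[Q+m]⇒q<2*k {k = k} (0<q F) q^d<|E||Θ| bound
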